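{- There are infinitely many triangular numbers which are products of two tetrahedral numbers; i.e., there are infinitely many positive integers $z$ (giving infinitely many distinct values $t_z$) such that $t_z = T_x T_y$ for some positive integers $x, y$.
   Context: $t_n = \frac{n(n+1)}{2}$ is the $n$-th triangular number and $T_n = \frac{n(n+1)(n+2)}{6}$ is the $n$-th tetrahedral number. -}

module Defs where

open import Data.Nat using (ℕ; suc; _+_; _*_; _/_)

tri : ℕ → ℕ
tri n = (n * (n + 1)) / 2

tet : ℕ → ℕ
tet n = (n * (n + 1) * (n + 2)) / 6

module Submission where

-- For every c the pair z = 2(3c+1)(12c+7), y = 12c+5 satisfies the
-- polynomial identity
--     t_z = (3c+1)(12c+7)(72c²+66c+15) = 3(3c+1) · T_y ,
-- because T_y = (12c+5)(2c+1)(12c+7).  So a solution of t_z = T_x T_y is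
-- obtained whenever the cofactor 3(3c+1) is itself tetrahedral.  This happens
-- along the arithmetic progression x = 54m+7: there T_x = 3(3c+1) with
--     c = 2916m³ + 1296m² + 191m + 9 .
-- Since m ≤ c < z, taking m = N gives a solution with z > N.

open import Defs
open import Data.Nat using (ℕ; NonZero; _<_; _≤_; _*_; _+_; _/_; s≤s; z≤n)
open import Data.Nat.Properties using (≤-trans; ≤-reflexive; m≤m+n; m≤n+m)
open import Data.Nat.DivMod using (m*n/n≡m)
open import Data.Nat.Tactic.RingSolver using (solve-∀)
open import Data.Product using (_×_; ∃-syntax; _,_)
open import Relation.Binary.PropositionalEquality
  using (_≡_; sym; trans; cong; module ≡-Reasoning)

exact-quotient : ∀ a q d .{{_ : NonZero d}} → a ≡ q * d → a / d ≡ q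
exact-quotient a q d a≡q*d = trans (cong (_/ d) a≡q*d) (m*n/n≡m q d)

tri-from : ∀ n q → n * (n + 1) ≡ q * 2 → tri n ≡ q
tri-from n q = exact-quotient _ q 2

tet-from : ∀ n q → n * (n + 1) * (n + 2) ≡ q * 6 → tet n ≡ q
tet-from n q = exact-quotient _ q 6

z-of : ℕ → ℕ
z-of c = 2 * (3 * c + 1) * (12 * c + 7)

y-of : ℕ → ℕ
y-of c = 12 * c + 5

-- Closed form of T_y: the factor 12c+6 of y(y+1)(y+2) absorbs the 6.
tet-y-of : ∀ c → tet (y-of c) ≡ (12 * c + 5) * (2 * c + 1) * (12 * c + 7)
tet-y-of c = tet-from (y-of c) _ (identity c)
  where
  identity : ∀ c → (12 * c + 5) * (12 * c + 5 + 1) * (12 * c + 5 + 2)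
                 ≡ ((12 * c + 5) * (2 * c + 1) * (12 * c + 7)) * 6
  identity = solve-∀

tri-z-of : ∀ c → tri (z-of c) ≡ 3 * (3 * c + 1) * tet (y-of c)
tri-z-of c = begin
    tri (z-of c)
  ≡⟨ tri-from (z-of c) _ (halve c) ⟩
    (3 * c + 1) * (12 * c + 7) * (72 * c * c + 66 * c + 15)
  ≡⟨ regroup c ⟩
    3 * (3 * c + 1) * ((12 * c + 5) * (2 * c + 1) * (12 * c + 7))
  ≡⟨ cong (3 * (3 * c + 1) *_) (sym (tet-y-of c)) ⟩
    3 * (3 * c + 1) * tet (y-of c)
  ∎
  where
  open ≡-Reasoning
  halve : ∀ c → (2 * (3 * c + 1) * (12 * c + 7)) * (2 * (3 * c + 1) * (12 * c + 7) + 1)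
              ≡ ((3 * c + 1) * (12 * c + 7) * (72 * c * c + 66 * c + 15)) * 2
  halve = solve-∀
  regroup : ∀ c → (3 * c + 1) * (12 * c + 7) * (72 * c * c + 66 * c + 15)
                ≡ 3 * (3 * c + 1) * ((12 * c + 5) * (2 * c + 1) * (12 * c + 7))
  regroup = solve-∀

tri-z-of-if-cofactor-tet : ∀ c x → tet x ≡ 3 * (3 * c + 1)
                         → tri (z-of c) ≡ tet x * tet (y-of c)
tri-z-of-if-cofactor-tet c x Tx≡cofactor =
  trans (tri-z-of c) (cong (_* tet (y-of c)) (sym Tx≡cofactor))

c-of : ℕ → ℕ
c-of m = 2916 * m * m * m + 1296 * m * m + 191 * m + 9

x-of : ℕ → ℕ
x-of m = 54 * m + 7

tet-x-of : ∀ m → tet (x-of m) ≡ 3 * (3 * c-of m + 1)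
tet-x-of m = tet-from (x-of m) _ (identity m)
  where
  identity : ∀ m → (54 * m + 7) * (54 * m + 7 + 1) * (54 * m + 7 + 2)
                 ≡ (3 * (3 * (2916 * m * m * m + 1296 * m * m + 191 * m + 9) + 1)) * 6
  identity = solve-∀

m≤c-of : ∀ m → m ≤ c-of m
m≤c-of m = ≤-trans (m≤m+n m _) (≤-reflexive (sym (expand m)))
  where
  expand : ∀ m → 2916 * m * m * m + 1296 * m * m + 191 * m + 9
               ≡ m + (2916 * m * m * m + 1296 * m * m + 190 * m + 9)
  expand = solve-∀

c<z-of : ∀ c → c < z-of c
c<z-of c = ≤-trans (s≤s (m≤m+n c _)) (≤-reflexive (sym (expand c)))
  where
  expand : ∀ c → 2 * (3 * c + 1) * (12 * c + 7) ≡ 1 + c + (72 * c * c + 65 * c + 13)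
  expand = solve-∀

0<+suc : ∀ a k → 0 < a + (1 + k)
0<+suc a k = ≤-trans (s≤s z≤n) (m≤n+m (1 + k) a)

theorem5p2 : ∀ (N : ℕ) → ∃[ z ] ∃[ x ] ∃[ y ] (N < z × 0 < x × 0 < y × tri z ≡ tet x * tet y)
theorem5p2 N =
  z-of c , x-of N , y-of c ,
  ≤-trans (s≤s (m≤c-of N)) (c<z-of c) ,
  0<+suc (54 * N) 6 ,
  0<+suc (12 * c) 4 ,
  tri-z-of-if-cofactor-tet c (x-of N) (tet-x-of N)
  where
  c : ℕ
  c = c-of N
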